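{- Let $f\colon\mathbb F_2^n\to\mathbb F_2$ and $g\colon\mathbb F_2^m\to\mathbb F_2$ be bent functions. If $\operatorname{rind}(f)<n/2$ and $\operatorname{rind}(g)\le m/2$, then for every $k\in\mathbb N$ the function $f\oplus k\cdot g$ on $\mathbb F_2^{n+km}$ does not belong to $\mathcal{M}^{\#}$.
   Context: A Boolean function $F$ on $\mathbb F_2^N$ is bent if for every nonzero $\mathbf{a}$ and every $b\in\mathbb F_2$ the equation $F(\mathbf{z}\oplus\mathbf{a})\oplus F(\mathbf{z})=b$ has $2^{N-1}$ solutions. $D_{\mathbf{a},\mathbf{b}}F(\mathbf{z})=F(\mathbf{z}\oplus\mathbf{a}\oplus\mathbf{b})\oplus F(\mathbf{z}\oplus\mathbf{a})\oplus F(\mathbf{z}\oplus\mathbf{b})\oplus F(\mathbf{z})$. A subspace $U$ is a relaxed $\mathcal{M}$-subspace of $F$ if $D_{\mathbf{a},\mathbf{b}}F$ is constant (zero or one) for all $\mathbf{a},\mathbf{b}\in U$; $\operatorname{rind}(F)$ is the maximal dimension of a relaxed $\mathcal{M}$-subspace of $F$. The $k$-fold direct sum is $k\cdot g(\mathbf{y}_1,\dots,\mathbf{y}_k)=g(\mathbf{y}_1)\oplus\cdots\oplus g(\mathbf{y}_k)$, and $(f\oplus k\cdot g)(\mathbf{x},\mathbf{y}_1,\dots,\mathbf{y}_k)=f(\mathbf{x})\oplus k\cdot g(\mathbf{y}_1,\dots,\mathbf{y}_k)$. Two functions $F,F'$ on $\mathbb F_2^N$ are equivalent if $F'(\mathbf{z})=F(\mathbf{z}A)\oplus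 l(\mathbf{z})$ with $A\in AGL(N,2)$ and $l$ affine. For even $N=2t$, the completed Maiorana–McFarland class $\mathcal{M}^{\#}$ on $\mathbb F_2^N$ is the set of functions equivalent to a function $(\mathbf{x},\mathbf{y})\mapsto\langle\mathbf{x},\pi(\mathbf{y})\rangle_t\oplus\phi(\mathbf{y})$ with $\mathbf{x},\mathbf{y}\in\mathbb F_2^t$, $\pi\colon\mathbb F_2^t\to\mathbb F_2^t$ and $\phi\colon\mathbb F_2^t\to\mathbb F_2$. -}

module Defs where

open import Data.Bool using (Bool; true; false; _xor_; _∧_)
open import Data.Bool.Properties using () renaming (_≟_ to _≟B_)
open import Data.Nat using (ℕ; zero; suc; _+_; _*_; _∸_; _^_)
open import Data.Fin using (Fin) renaming (zero to fzero; suc to fsuc)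
open import Data.Vec using (Vec; map; []; _∷_; zipWith; replicate; splitAt; foldr; lookup; tabulate)
open import Data.List using (List; filter; length; concatMap) renaming ([] to []ₗ; _∷_ to _∷ₗ_; map to mapₗ)
open import Data.Product using (Σ; ∃; _×_; _,_; proj₁)
open import Relation.Binary.PropositionalEquality using (_≡_; _≢_; subst; sym)

F2^ : ℕ → Set
F2^ N = Vec Bool N

BoolFun : ℕ → Set
BoolFun N = F2^ N → Bool

infixl 6 _⊕_
_⊕_ : ∀ {N} → F2^ N → F2^ N → F2^ N
_⊕_ = zipWith _xor_

zeroV : ∀ {N} → F2^ N
zeroV = replicate _ false

⟨_,_⟩ : ∀ {N} → F2^ N → F2^ N → Bool
⟨ x , y ⟩ = foldr _ _xor_ false (zipWith _∧_ x y)

allVecs : (N : ℕ) → List (F2^ N)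
allVecs zero = [] ∷ₗ []ₗ
allVecs (suc N) = concatMap (λ v → (false ∷ v) ∷ₗ (true ∷ v) ∷ₗ []ₗ) (allVecs N)

countDeriv : ∀ {N} → BoolFun N → F2^ N → Bool → ℕ
countDeriv {N} F a b = length (filter (λ z → (F (z ⊕ a) xor F z) ≟B b) (allVecs N))

IsBent : ∀ {N} → BoolFun N → Set
IsBent {N} F = ∀ (a : F2^ N) → a ≢ zeroV → ∀ (b : Bool) → countDeriv F a b ≡ 2 ^ (N ∸ 1)

D2 : ∀ {N} → F2^ N → F2^ N → BoolFun N → BoolFun N
D2 a b F z = F (z ⊕ a ⊕ b) xor F (z ⊕ a) xor F (z ⊕ b) xor F z

lincomb : ∀ {N d} → (Fin d → F2^ N) → F2^ d → F2^ N
lincomb {N} {zero} B [] = zeroV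
lincomb {N} {suc d} B (c ∷ cs) =
  zipWith _xor_ (map (c ∧_) (B fzero)) (lincomb (λ i → B (fsuc i)) cs)

LinIndep : ∀ {N d} → (Fin d → F2^ N) → Set
LinIndep {N} {d} B = ∀ (c : F2^ d) → lincomb B c ≡ zeroV → c ≡ zeroV

-- The subspace U = span(B), with B a basis (so dim U = d), is a relaxed
-- M-subspace of F: D_{a,b} F is constant for all a, b ∈ U.
IsRelaxedMSubspace : ∀ {N} → BoolFun N → (d : ℕ) → (Fin d → F2^ N) → Set
IsRelaxedMSubspace {N} F d B =
  LinIndep B ×
  (∀ (c c' : F2^ d) → ∃ λ (e : Bool) → ∀ (z : F2^ N) → D2 (lincomb B c) (lincomb B c') F z ≡ e)

-- rind(F) < r/2  (as 2·rind(F) < r), rind(F) ≤ r/2 (as 2·rind(F) ≤ r):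
-- every relaxed M-subspace has dimension d with 2d < r (resp. 2d ≤ r).
open import Data.Nat using (_<_; _≤_)

RindLtHalf : ∀ {N} → BoolFun N → ℕ → Set
RindLtHalf {N} F r = ∀ (d : ℕ) (B : Fin d → F2^ N) → IsRelaxedMSubspace F d B → 2 * d < r

RindLeHalf : ∀ {N} → BoolFun N → ℕ → Set
RindLeHalf {N} F r = ∀ (d : ℕ) (B : Fin d → F2^ N) → IsRelaxedMSubspace F d B → 2 * d ≤ r

kfold : ∀ {m} (k : ℕ) → BoolFun m → BoolFun (k * m)
kfold zero g _ = false
kfold {m} (suc k) g v with splitAt m v
... | y , rest , _ = g y xor kfold k g rest

dirSum : ∀ {n m} → BoolFun n → (k : ℕ) → BoolFun m → BoolFun (n + k * m)
dirSum {n} f k g v with splitAt n v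
... | x , ys , _ = f x xor kfold k g ys

Matrix : ℕ → Set
Matrix N = Vec (F2^ N) N

vecMat : ∀ {N} → F2^ N → Matrix N → F2^ N
vecMat {N} z M = lincomb (lookup M) z

Invertible : ∀ {N} → Matrix N → Set
Invertible {N} M = Σ (Matrix N) λ M' →
  (∀ (z : F2^ N) → vecMat (vecMat z M) M' ≡ z) × (∀ (z : F2^ N) → vecMat (vecMat z M') M ≡ z)

MM : ∀ {t} → (F2^ t → F2^ t) → (F2^ t → Bool) → BoolFun (t + t)
MM {t} π φ v with splitAt t v
... | x , y , _ = ⟨ x , π y ⟩ xor φ y

-- Completed Maiorana–McFarland class M^# on F_2^N (N = 2t):
-- F(z) = h(zM ⊕ v) ⊕ ⟨z , w⟩ ⊕ c, with h Maiorana–McFarland,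
-- zM ⊕ v ∈ AGL(N,2) and z ↦ ⟨z,w⟩ ⊕ c affine.
InMSharp : ∀ {N} → BoolFun N → Set
InMSharp {N} F =
  Σ ℕ λ t → Σ (t + t ≡ N) λ eq →
  Σ (F2^ t → F2^ t) λ π → Σ (F2^ t → Bool) λ φ →
  Σ (Matrix N) λ M → Invertible M × (Σ (F2^ N) λ v → Σ (F2^ N) λ w → Σ Bool λ c →
    ∀ (z : F2^ N) →
      F z ≡ (MM π φ (subst F2^ (sym eq) (vecMat z M ⊕ v)) xor ⟨ z , w ⟩ xor c))

-- A function in M# on F2^(2t) has a relaxed M-subspace of dimension t: a
-- Maiorana–McFarland function is affine in x, so its second derivatives along the x-directions
-- vanish, and this survives affine changes of variables and adding affine functions.
-- Conversely, if F(x, y) = F₁(x) ⊕ F₂(y) and U is a relaxed M-subspace of F, then the projection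
-- of U to the x-coordinates and the y-parts of U ∩ (0 × F2^q) are relaxed M-subspaces of F₁ and F₂,
-- whose dimensions add up to dim U by rank–nullity.  Hence 2·rind(f ⊕ k·g) < n + km, so
-- f ⊕ k·g has no relaxed M-subspace of half dimension and cannot lie in M#.
module Submission where

open import Defs
open import Data.Nat using (ℕ; _+_; _*_)
open import Relation.Nullary using (¬_)

open import Algebra.Bundles using (AbelianGroup)
open import Data.Bool using (Bool; true; false; _xor_; _∧_)
open import Data.Bool.Properties
  using (xor-assoc; xor-comm; xor-identityˡ; xor-identityʳ; xor-same; ∧-zeroʳ; ∧-distribʳ-xor; ∧-distribˡ-xor; ∧-assoc)
  renaming (_≟_ to _≟B_)
open import Data.Bool.Solver using (module xor-∧-Solver)
open import Data.Empty using (⊥-elim)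
open import Data.Fin using (Fin; _↑ˡ_) renaming (zero to fzero; suc to fsuc)
open import Data.Nat using (zero; suc; _≤_; _<_; z≤n)
open import Data.Nat.Properties using (*-distribˡ-+; +-suc; +-mono-≤; +-mono-<-≤; +-identityʳ; <-irrefl)
open import Data.Product using (Σ; ∃; _×_; _,_; proj₁; proj₂)
open import Data.Sum using (inj₁; inj₂)
open import Data.Vec using ([]; _∷_; map; take; drop; _++_; head; tail; lookup)
open import Data.Vec.Properties
  using (zipWith-assoc; zipWith-comm; zipWith-identityˡ; zipWith-identityʳ; zipWith-inverseˡ; map-id; take-zipWith;
         drop-zipWith; take-map; drop-map; take++drop≡id; ++-injective; zipWith-++; ≡-dec)
import Data.Vec.Functional as Family
open import Function using (id; _∘_)
open import Level using (0ℓ)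
open import Relation.Binary.PropositionalEquality using (_≡_; refl; sym; trans; cong; cong₂; subst; subst₂; isEquivalence; module ≡-Reasoning)
open import Relation.Nullary using (Dec; yes; no)
open import Relation.Nullary.Decidable using (map′; _⊎-dec_)

open xor-∧-Solver using (solve; _:+_; _:*_; _:=_; con)

xor-interchange₄ : ∀ a₁ a₂ b₁ b₂ c₁ c₂ d₁ d₂ →
  (a₁ xor a₂) xor (b₁ xor b₂) xor (c₁ xor c₂) xor (d₁ xor d₂) ≡
  (a₁ xor b₁ xor c₁ xor d₁) xor (a₂ xor b₂ xor c₂ xor d₂)
xor-interchange₄ = solve 8 (λ a₁ a₂ b₁ b₂ c₁ c₂ d₁ d₂ →
  (a₁ :+ a₂) :+ ((b₁ :+ b₂) :+ ((c₁ :+ c₂) :+ (d₁ :+ d₂))) :=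
  (a₁ :+ (b₁ :+ (c₁ :+ d₁))) :+ (a₂ :+ (b₂ :+ (c₂ :+ d₂)))) refl

xor-same₄ : ∀ c → c xor c xor c xor c ≡ false
xor-same₄ = solve 1 (λ c → c :+ (c :+ (c :+ c)) := con false) refl

xor-cancel₄ : ∀ x y w → ((x xor y) xor w) xor (x xor y) xor (x xor w) xor x ≡ false
xor-cancel₄ = solve 3 (λ x y w → ((x :+ y) :+ w) :+ ((x :+ y) :+ ((x :+ w) :+ x)) := con false) refl

∧-xor-interchange : ∀ a b c x y → ((a xor b) ∧ c) xor (x xor y) ≡ ((a ∧ c) xor x) xor ((b ∧ c) xor y)
∧-xor-interchange = solve 5 (λ a b c x y → ((a :+ b) :* c) :+ (x :+ y) := ((a :* c) :+ x) :+ ((b :* c) :+ y)) refl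

xor-solveˡ : ∀ x y {e} → x xor y ≡ e → x ≡ e xor y
xor-solveˡ x y refl = solve 2 (λ x y → x := (x :+ y) :+ y) refl x y

xor-solveʳ : ∀ x y {e} → x xor y ≡ e → y ≡ e xor x
xor-solveʳ x y refl = solve 2 (λ x y → y := (x :+ y) :+ x) refl x y

⊕-self : ∀ {N} (x : F2^ N) → x ⊕ x ≡ zeroV
⊕-self x = trans (cong (_⊕ x) (sym (map-id x))) (zipWith-inverseˡ xor-same x)

⊕-abelianGroup : ℕ → AbelianGroup 0ℓ 0ℓ
⊕-abelianGroup N = record
  { Carrier = F2^ N
  ; _≈_ = _≡_
  ; _∙_ = _⊕_
  ; ε = zeroV
  ; _⁻¹ = id
  ; isAbelianGroup = record
    { isGroup = record
      { isMonoid = record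
        { isSemigroup = record
          { isMagma = record { isEquivalence = isEquivalence ; ∙-cong = cong₂ _⊕_ }
          ; assoc = zipWith-assoc xor-assoc }
        ; identity = zipWith-identityˡ xor-identityˡ , zipWith-identityʳ xor-identityʳ }
      ; inverse = ⊕-self , ⊕-self
      ; ⁻¹-cong = id }
    ; comm = zipWith-comm xor-comm } }

module _ {N : ℕ} where
  open AbelianGroup (⊕-abelianGroup N) public
    using () renaming (identityˡ to ⊕-identityˡ; identityʳ to ⊕-identityʳ)
  open import Algebra.Properties.AbelianGroup (⊕-abelianGroup N) public
    using () renaming (inverseˡ-unique to ⊕≡zeroV⇒≡)
  open import Algebra.Properties.CommutativeSemigroup (AbelianGroup.commutativeSemigroup (⊕-abelianGroup N)) public
    using () renaming (interchange to ⊕-interchange; xy∙z≈xz∙y to ⊕-swapʳ)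

infixr 7 _·_

-- Written exactly as in lincomb, so that lincomb B (c ∷ cs) is c · B fzero ⊕ … by definition.
_·_ : ∀ {N} → Bool → F2^ N → F2^ N
c · v = map (c ∧_) v

·-zeroˡ : ∀ {N} (v : F2^ N) → false · v ≡ zeroV
·-zeroˡ [] = refl
·-zeroˡ (_ ∷ v) = cong (false ∷_) (·-zeroˡ v)

·-identityˡ : ∀ {N} (v : F2^ N) → true · v ≡ v
·-identityˡ [] = refl
·-identityˡ (x ∷ v) = cong (x ∷_) (·-identityˡ v)

·-distribʳ : ∀ {N} a b (v : F2^ N) → (a xor b) · v ≡ a · v ⊕ b · v
·-distribʳ a b [] = refl
·-distribʳ a b (x ∷ v) = cong₂ _∷_ (∧-distribʳ-xor x a b) (·-distribʳ a b v)

·-distribˡ : ∀ {N} c (x y : F2^ N) → c · (x ⊕ y) ≡ c · x ⊕ c · y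
·-distribˡ c [] [] = refl
·-distribˡ c (a ∷ x) (b ∷ y) = cong₂ _∷_ (∧-distribˡ-xor c a b) (·-distribˡ c x y)

·-assoc : ∀ {N} a b (v : F2^ N) → (a ∧ b) · v ≡ a · b · v
·-assoc a b [] = refl
·-assoc a b (x ∷ v) = cong₂ _∷_ (∧-assoc a b x) (·-assoc a b v)

·-zeroʳ : ∀ {N} a → a · zeroV {N} ≡ zeroV
·-zeroʳ {zero} a = refl
·-zeroʳ {suc N} a = cong₂ _∷_ (∧-zeroʳ a) (·-zeroʳ a)

take-++ : ∀ {p q} (x : F2^ p) (y : F2^ q) → take p (x ++ y) ≡ x
take-++ {p} x y = proj₁ (++-injective (take p (x ++ y)) x (take++drop≡id p (x ++ y)))

drop-++ : ∀ {p q} (x : F2^ p) (y : F2^ q) → drop p (x ++ y) ≡ y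
drop-++ {p} x y = proj₂ (++-injective (take p (x ++ y)) x (take++drop≡id p (x ++ y)))

zeroV-++ : ∀ {p q} → zeroV {p} ++ zeroV {q} ≡ zeroV
zeroV-++ {zero} = refl
zeroV-++ {suc p} = cong (false ∷_) (zeroV-++ {p})

++-⊕ : ∀ {p q} (x a : F2^ p) (y b : F2^ q) → (x ++ y) ⊕ (a ++ b) ≡ (x ⊕ a) ++ (y ⊕ b)
++-⊕ x a y b = zipWith-++ _xor_ x y a b

record IsLinear {M N} (P : F2^ M → F2^ N) : Set where
  field
    ⊕-homo : ∀ x y → P (x ⊕ y) ≡ P x ⊕ P y
    ·-homo : ∀ a x → P (a · x) ≡ a · P x

  zero-homo : P zeroV ≡ zeroV
  zero-homo = begin
    P zeroV           ≡⟨ cong P (sym (·-zeroˡ zeroV)) ⟩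
    P (false · zeroV) ≡⟨ ·-homo false zeroV ⟩
    false · P zeroV   ≡⟨ ·-zeroˡ (P zeroV) ⟩
    zeroV             ∎
    where open ≡-Reasoning

  lincomb-homo : ∀ {d} (B : Fin d → F2^ M) c → P (lincomb B c) ≡ lincomb (P ∘ B) c
  lincomb-homo {zero} B [] = zero-homo
  lincomb-homo {suc d} B (c ∷ cs) =
    trans (⊕-homo _ _) (cong₂ _⊕_ (·-homo c (B fzero)) (lincomb-homo (B ∘ fsuc) cs))

take-isLinear : ∀ p {q} → IsLinear (take p {q})
take-isLinear p = record
  { ⊕-homo = take-zipWith _xor_
  ; ·-homo = λ a x → take-map (a ∧_) p x }

drop-isLinear : ∀ p {q} → IsLinear (drop p {q})
drop-isLinear p = record
  { ⊕-homo = drop-zipWith _xor_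
  ; ·-homo = λ a x → drop-map (a ∧_) p x }

lincomb-⊕ : ∀ {N d} (B : Fin d → F2^ N) c c' → lincomb B (c ⊕ c') ≡ lincomb B c ⊕ lincomb B c'
lincomb-⊕ {d = zero} B [] [] = sym (⊕-identityˡ zeroV)
lincomb-⊕ {d = suc d} B (a ∷ c) (b ∷ c') =
  trans (cong₂ _⊕_ (·-distribʳ a b (B fzero)) (lincomb-⊕ (B ∘ fsuc) c c'))
        (⊕-interchange _ _ _ _)

lincomb-· : ∀ {N d} (B : Fin d → F2^ N) a c → lincomb B (a · c) ≡ a · lincomb B c
lincomb-· {d = zero} B a [] = sym (·-zeroʳ a)
lincomb-· {d = suc d} B a (b ∷ c) =
  trans (cong₂ _⊕_ (·-assoc a b (B fzero)) (lincomb-· (B ∘ fsuc) a c))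
        (sym (·-distribˡ a _ _))

lincomb-isLinear : ∀ {N d} (B : Fin d → F2^ N) → IsLinear (lincomb B)
lincomb-isLinear B = record { ⊕-homo = lincomb-⊕ B ; ·-homo = lincomb-· B }

lincomb-false∷ : ∀ {N d} (B : Fin (suc d) → F2^ N) c → lincomb B (false ∷ c) ≡ lincomb (B ∘ fsuc) c
lincomb-false∷ B c = trans (cong (_⊕ lincomb (B ∘ fsuc) c) (·-zeroˡ (B fzero))) (⊕-identityˡ _)

lincomb-true∷ : ∀ {N d} (B : Fin (suc d) → F2^ N) c → lincomb B (true ∷ c) ≡ B fzero ⊕ lincomb (B ∘ fsuc) c
lincomb-true∷ B c = cong (_⊕ lincomb (B ∘ fsuc) c) (·-identityˡ (B fzero))

lincomb-false∷ᶠ : ∀ {N d} (K : Fin d → F2^ N) c → lincomb ((false ∷_) ∘ K) c ≡ false ∷ lincomb K c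
lincomb-false∷ᶠ {d = zero} K [] = refl
lincomb-false∷ᶠ {d = suc d} K (c ∷ cs) =
  cong₂ _⊕_ (cong (_∷ c · K fzero) (∧-zeroʳ c)) (lincomb-false∷ᶠ (K ∘ fsuc) cs)

lincomb-zeroV-family : ∀ {N d} (B : Fin d → F2^ N) → (∀ i → B i ≡ zeroV) → ∀ c → lincomb B c ≡ zeroV
lincomb-zeroV-family {d = zero} B B≡0 [] = refl
lincomb-zeroV-family {d = suc d} B B≡0 (c ∷ cs) = begin
  c · B fzero ⊕ lincomb (B ∘ fsuc) cs
    ≡⟨ cong₂ _⊕_ (cong (c ·_) (B≡0 fzero)) (lincomb-zeroV-family (B ∘ fsuc) (B≡0 ∘ fsuc) cs) ⟩
  c · zeroV ⊕ zeroV                   ≡⟨ ⊕-identityʳ _ ⟩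
  c · zeroV                           ≡⟨ ·-zeroʳ c ⟩
  zeroV                               ∎
  where open ≡-Reasoning

lincomb-↑ˡ : ∀ {N} d t (A : Fin (d + t) → F2^ N) c → lincomb (A ∘ (_↑ˡ t)) c ≡ lincomb A (c ++ zeroV)
lincomb-↑ˡ zero t A [] = sym (IsLinear.zero-homo (lincomb-isLinear A))
lincomb-↑ˡ (suc d) t A (c ∷ cs) = cong (c · A fzero ⊕_) (lincomb-↑ˡ d t (A ∘ fsuc) cs)

LinIndep-F2^0 : ∀ {d} (B : Fin d → F2^ 0) → LinIndep B → d ≡ 0
LinIndep-F2^0 {zero} B _ = refl
LinIndep-F2^0 {suc d} B indep with lincomb B (true ∷ zeroV) | indep (true ∷ zeroV)
... | [] | indep-at with indep-at refl
...   | ()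

infix 4 _∈Span_ _∈Span?_

_∈Span_ : ∀ {N d} → F2^ N → (Fin d → F2^ N) → Set
v ∈Span B = ∃ λ c → lincomb B c ≡ v

∃-F2^? : ∀ d {P : F2^ d → Set} → (∀ v → Dec (P v)) → Dec (∃ P)
∃-F2^? zero P? = map′ ([] ,_) (λ { ([] , p) → p }) (P? [])
∃-F2^? (suc d) P? =
  map′ (λ { (inj₁ (v , p)) → false ∷ v , p ; (inj₂ (v , p)) → true ∷ v , p })
       (λ { (false ∷ v , p) → inj₁ (v , p) ; (true ∷ v , p) → inj₂ (v , p) })
       (∃-F2^? d (P? ∘ (false ∷_)) ⊎-dec ∃-F2^? d (P? ∘ (true ∷_)))

_∈Span?_ : ∀ {N d} (v : F2^ N) (B : Fin d → F2^ N) → Dec (v ∈Span B)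
v ∈Span? B = ∃-F2^? _ (λ c → ≡-dec _≟B_ (lincomb B c) v)

record RankNullity {p d} (T : Fin d → F2^ p) : Set where
  field
    rank nullity : ℕ
    rank+nullity : rank + nullity ≡ d
    basis : Fin rank → F2^ p
    basis-indep : LinIndep basis
    basis-⊆span : ∀ c → lincomb basis c ∈Span T
    kernel : Fin nullity → F2^ d
    kernel-indep : LinIndep kernel
    kernel-⊆ker : ∀ j → lincomb T (kernel j) ≡ zeroV

LinIndep-false∷ᶠ : ∀ {N d} {K : Fin d → F2^ N} → LinIndep K → LinIndep ((false ∷_) ∘ K)
LinIndep-false∷ᶠ {K = K} indep c eq = indep c (cong tail (trans (sym (lincomb-false∷ᶠ K c)) eq))

module _ {p d} (T : Fin (suc d) → F2^ p) (R : RankNullity (T ∘ fsuc)) where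
  open RankNullity R

  rankNullity-∷-∉ : ¬ (T fzero ∈Span basis) → RankNullity T
  rankNullity-∷-∉ t₀∉ = record
    { rank = suc rank
    ; nullity = nullity
    ; rank+nullity = cong suc rank+nullity
    ; basis = T fzero Family.∷ basis
    ; basis-indep = extended-indep
    ; basis-⊆span = extended-⊆span
    ; kernel = (false ∷_) ∘ kernel
    ; kernel-indep = LinIndep-false∷ᶠ kernel-indep
    ; kernel-⊆ker = λ j → trans (lincomb-false∷ T (kernel j)) (kernel-⊆ker j) }
    where
    extended-indep : LinIndep (T fzero Family.∷ basis)
    extended-indep (true ∷ c) eq =
      ⊥-elim (t₀∉ (c , sym (⊕≡zeroV⇒≡ _ _ (trans (sym (lincomb-true∷ (T fzero Family.∷ basis) c)) eq))))
    extended-indep (false ∷ c) eq =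
      cong (false ∷_) (basis-indep c (trans (sym (lincomb-false∷ (T fzero Family.∷ basis) c)) eq))
    extended-⊆span : ∀ c → lincomb (T fzero Family.∷ basis) c ∈Span T
    extended-⊆span (c₀ ∷ c) with c' , h ← basis-⊆span c = c₀ ∷ c' , cong (c₀ · T fzero ⊕_) h

  rankNullity-∷-∈ : T fzero ∈Span basis → RankNullity T
  rankNullity-∷-∈ (e , basis·e≡t₀) = record
    { rank = rank
    ; nullity = suc nullity
    ; rank+nullity = trans (+-suc rank nullity) (cong suc rank+nullity)
    ; basis = basis
    ; basis-indep = basis-indep
    ; basis-⊆span = λ c → let c' , h = basis-⊆span c in false ∷ c' , trans (lincomb-false∷ T c') h
    ; kernel = extended-kernel
    ; kernel-indep = extended-indep
    ; kernel-⊆ker = extended-⊆ker }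
    where
    e' : F2^ d
    e' = proj₁ (basis-⊆span e)
    T·e'≡t₀ : lincomb (T ∘ fsuc) e' ≡ T fzero
    T·e'≡t₀ = trans (proj₂ (basis-⊆span e)) basis·e≡t₀
    extended-kernel : Fin (suc nullity) → F2^ (suc d)
    extended-kernel = (true ∷ e') Family.∷ ((false ∷_) ∘ kernel)
    extended-indep : LinIndep extended-kernel
    extended-indep (false ∷ c) eq =
      cong (false ∷_) (LinIndep-false∷ᶠ kernel-indep c (trans (sym (lincomb-false∷ extended-kernel c)) eq))
    -- a combination using the new kernel vector true ∷ e' has first coordinate true
    extended-indep (true ∷ c) eq
      with () ← cong head (trans (cong (true · (true ∷ e') ⊕_) (sym (lincomb-false∷ᶠ kernel c))) eq)
    extended-⊆ker : ∀ j → lincomb T (extended-kernel j) ≡ zeroV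
    extended-⊆ker fzero = begin
      lincomb T (true ∷ e')              ≡⟨ lincomb-true∷ T e' ⟩
      T fzero ⊕ lincomb (T ∘ fsuc) e'    ≡⟨ cong (T fzero ⊕_) T·e'≡t₀ ⟩
      T fzero ⊕ T fzero                  ≡⟨ ⊕-self (T fzero) ⟩
      zeroV                              ∎
      where open ≡-Reasoning
    extended-⊆ker (fsuc j) = trans (lincomb-false∷ T (kernel j)) (kernel-⊆ker j)

rankNullity : ∀ {p} d (T : Fin d → F2^ p) → RankNullity T
rankNullity zero T = record
  { rank = 0 ; nullity = 0 ; rank+nullity = refl
  ; basis = λ () ; basis-indep = λ { [] _ → refl } ; basis-⊆span = λ { [] → [] , refl }
  ; kernel = λ () ; kernel-indep = λ { [] _ → refl } ; kernel-⊆ker = λ () }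
rankNullity (suc d) T with R ← rankNullity d (T ∘ fsuc) with T fzero ∈Span? RankNullity.basis R
... | yes t₀∈ = rankNullity-∷-∈ T R t₀∈
... | no t₀∉ = rankNullity-∷-∉ T R t₀∉

D2-Constant : ∀ {N} → BoolFun N → F2^ N → F2^ N → Set
D2-Constant F a b = ∃ λ (e : Bool) → ∀ z → D2 a b F z ≡ e

D2-cong : ∀ {N} {F G : BoolFun N} → (∀ u → F u ≡ G u) → ∀ a b z → D2 a b F z ≡ D2 a b G z
D2-cong F≗G a b z = cong₂ _xor_ (F≗G _) (cong₂ _xor_ (F≗G _) (cong₂ _xor_ (F≗G _) (F≗G _)))

D2-xor : ∀ {N} (F G : BoolFun N) a b z → D2 a b (λ u → F u xor G u) z ≡ D2 a b F z xor D2 a b G z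
D2-xor F G a b z =
  xor-interchange₄ (F (z ⊕ a ⊕ b)) (G (z ⊕ a ⊕ b)) (F (z ⊕ a)) (G (z ⊕ a)) (F (z ⊕ b)) (G (z ⊕ b)) (F z) (G z)

D2-const : ∀ {N} (c : Bool) (a b z : F2^ N) → D2 a b (λ _ → c) z ≡ false
D2-const c a b z = xor-same₄ c

D2-additive : ∀ {N} (L : BoolFun N) → (∀ x y → L (x ⊕ y) ≡ L x xor L y) → ∀ a b z → D2 a b L z ≡ false
D2-additive L L-⊕ a b z = begin
  D2 a b L z
    ≡⟨ cong₂ _xor_ L-⊕⊕ (cong₂ _xor_ (L-⊕ z a) (cong (_xor L z) (L-⊕ z b))) ⟩
  ((L z xor L a) xor L b) xor (L z xor L a) xor (L z xor L b) xor L z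
    ≡⟨ xor-cancel₄ (L z) (L a) (L b) ⟩
  false ∎
  where
  open ≡-Reasoning
  L-⊕⊕ : L (z ⊕ a ⊕ b) ≡ (L z xor L a) xor L b
  L-⊕⊕ = trans (L-⊕ (z ⊕ a) b) (cong (_xor L b) (L-⊕ z a))

D2-∘-affine : ∀ {M N} {P L : F2^ M → F2^ N} → (∀ u a → P (u ⊕ a) ≡ P u ⊕ L a) →
  ∀ (F : BoolFun N) a b z → D2 a b (F ∘ P) z ≡ D2 (L a) (L b) F (P z)
D2-∘-affine {P = P} {L} P-⊕ F a b z =
  cong₂ _xor_ (cong F P-⊕⊕) (cong₂ _xor_ (cong F (P-⊕ z a)) (cong₂ _xor_ (cong F (P-⊕ z b)) refl))
  where
  P-⊕⊕ : P (z ⊕ a ⊕ b) ≡ P z ⊕ L a ⊕ L b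
  P-⊕⊕ = trans (P-⊕ (z ⊕ a) b) (cong (_⊕ L b) (P-⊕ z a))

double-split : ∀ {d₁ d₂ d} → d₁ + d₂ ≡ d → 2 * d ≡ 2 * d₁ + 2 * d₂
double-split {d₁} {d₂} refl = *-distribˡ-+ 2 d₁ d₂

module _ {p q} {F : BoolFun (p + q)} {F₁ : BoolFun p} {F₂ : BoolFun q}
         (F-split : ∀ z → F z ≡ F₁ (take p z) xor F₂ (drop p z)) where

  D2-split : ∀ a b z →
    D2 a b F z ≡ D2 (take p a) (take p b) F₁ (take p z) xor D2 (drop p a) (drop p b) F₂ (drop p z)
  D2-split a b z = begin
    D2 a b F z
      ≡⟨ D2-cong F-split a b z ⟩
    D2 a b (λ u → F₁ (take p u) xor F₂ (drop p u)) z
      ≡⟨ D2-xor (F₁ ∘ take p) (F₂ ∘ drop p) a b z ⟩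
    D2 a b (F₁ ∘ take p) z xor D2 a b (F₂ ∘ drop p) z
      ≡⟨ cong₂ _xor_ (D2-∘-affine (IsLinear.⊕-homo (take-isLinear p)) F₁ a b z)
                     (D2-∘-affine (IsLinear.⊕-homo (drop-isLinear p)) F₂ a b z) ⟩
    D2 (take p a) (take p b) F₁ (take p z) xor D2 (drop p a) (drop p b) F₂ (drop p z) ∎
    where open ≡-Reasoning

  D2-split-++ : ∀ a b x y →
    D2 a b F (x ++ y) ≡ D2 (take p a) (take p b) F₁ x xor D2 (drop p a) (drop p b) F₂ y
  D2-split-++ a b x y =
    trans (D2-split a b (x ++ y))
          (cong₂ (λ x' y' → D2 (take p a) (take p b) F₁ x' xor D2 (drop p a) (drop p b) F₂ y')
                 (take-++ x y) (drop-++ x y))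

  D2-Constant-take : ∀ {a b} → D2-Constant F a b → D2-Constant F₁ (take p a) (take p b)
  D2-Constant-take {a} {b} (e , he) = e xor D2 (drop p a) (drop p b) F₂ zeroV , λ x →
    xor-solveˡ _ _ (trans (sym (D2-split-++ a b x zeroV)) (he _))

  D2-Constant-drop : ∀ {a b} → D2-Constant F a b → D2-Constant F₂ (drop p a) (drop p b)
  D2-Constant-drop {a} {b} (e , he) = e xor D2 (take p a) (take p b) F₁ zeroV , λ y →
    xor-solveʳ _ _ (trans (sym (D2-split-++ a b zeroV y)) (he _))

  relaxedMSubspace-split : ∀ {d} (B : Fin d → F2^ (p + q)) → IsRelaxedMSubspace F d B →
    Σ ℕ λ d₁ → Σ ℕ λ d₂ → d₁ + d₂ ≡ d ×
      Σ (Fin d₁ → F2^ p) (IsRelaxedMSubspace F₁ d₁) × Σ (Fin d₂ → F2^ q) (IsRelaxedMSubspace F₂ d₂)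
  relaxedMSubspace-split {d} B (B-indep , B-relaxed) =
    rank , nullity , rank+nullity , (basis , basis-indep , basis-relaxed) , (B₂ , B₂-indep , B₂-relaxed)
    where
    open RankNullity (rankNullity d (take p ∘ B))

    take-lincomb : ∀ c → take p (lincomb B c) ≡ lincomb (take p ∘ B) c
    take-lincomb = IsLinear.lincomb-homo (take-isLinear p) B

    B₂ : Fin nullity → F2^ q
    B₂ j = lincomb (drop p ∘ B) (kernel j)

    lift : F2^ nullity → F2^ (p + q)
    lift c = lincomb B (lincomb kernel c)

    take-lift : ∀ c → take p (lift c) ≡ zeroV
    take-lift c = trans (take-lincomb _)
      (trans (IsLinear.lincomb-homo (lincomb-isLinear (take p ∘ B)) kernel c)
             (lincomb-zeroV-family _ kernel-⊆ker c))

    drop-lift : ∀ c → drop p (lift c) ≡ lincomb B₂ c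
    drop-lift c = trans (IsLinear.lincomb-homo (drop-isLinear p) B _)
                        (IsLinear.lincomb-homo (lincomb-isLinear (drop p ∘ B)) kernel c)

    B₂-indep : LinIndep B₂
    B₂-indep c B₂·c≡0 = kernel-indep c (B-indep _ (begin
      lift c                             ≡⟨ take++drop≡id p (lift c) ⟨
      take p (lift c) ++ drop p (lift c) ≡⟨ cong₂ _++_ (take-lift c) (trans (drop-lift c) B₂·c≡0) ⟩
      zeroV {p} ++ zeroV {q}             ≡⟨ zeroV-++ {p} {q} ⟩
      zeroV                              ∎))
      where open ≡-Reasoning

    basis-relaxed : ∀ c c' → D2-Constant F₁ (lincomb basis c) (lincomb basis c')
    basis-relaxed c c' with e , he ← basis-⊆span c | e' , he' ← basis-⊆span c' =
      subst₂ (D2-Constant F₁) (trans (take-lincomb e) he) (trans (take-lincomb e') he')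
             (D2-Constant-take (B-relaxed e e'))

    B₂-relaxed : ∀ c c' → D2-Constant F₂ (lincomb B₂ c) (lincomb B₂ c')
    B₂-relaxed c c' =
      subst₂ (D2-Constant F₂) (drop-lift c) (drop-lift c') (D2-Constant-drop (B-relaxed _ _))

  rind-split-≤ : ∀ {r₁ r₂} → RindLeHalf F₁ r₁ → RindLeHalf F₂ r₂ → RindLeHalf F (r₁ + r₂)
  rind-split-≤ {r₁} {r₂} rind₁ rind₂ d B B-relaxed =
    let d₁ , d₂ , d₁+d₂≡d , (B₁ , B₁-relaxed) , (B₂ , B₂-relaxed) = relaxedMSubspace-split B B-relaxed
    in subst (_≤ r₁ + r₂) (sym (double-split {d₁} {d₂} d₁+d₂≡d))
         (+-mono-≤ (rind₁ d₁ B₁ B₁-relaxed) (rind₂ d₂ B₂ B₂-relaxed))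

  rind-split-< : ∀ {r₁ r₂} → RindLtHalf F₁ r₁ → RindLeHalf F₂ r₂ → RindLtHalf F (r₁ + r₂)
  rind-split-< {r₁} {r₂} rind₁ rind₂ d B B-relaxed =
    let d₁ , d₂ , d₁+d₂≡d , (B₁ , B₁-relaxed) , (B₂ , B₂-relaxed) = relaxedMSubspace-split B B-relaxed
    in subst (_< r₁ + r₂) (sym (double-split {d₁} {d₂} d₁+d₂≡d))
         (+-mono-<-≤ (rind₁ d₁ B₁ B₁-relaxed) (rind₂ d₂ B₂ B₂-relaxed))

rind-F2^0 : (F : BoolFun 0) → RindLeHalf F 0
rind-F2^0 F d B (B-indep , _) = subst (λ d → 2 * d ≤ 0) (sym (LinIndep-F2^0 B B-indep)) z≤n

rind-kfold : ∀ {m} {g : BoolFun m} → RindLeHalf g m → ∀ k → RindLeHalf (kfold k g) (k * m)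
rind-kfold {g = g} g-rind zero = rind-F2^0 (kfold zero g)
rind-kfold {g = g} g-rind (suc k) =
  rind-split-≤ {F₁ = g} {F₂ = kfold k g} (λ _ → refl) g-rind (rind-kfold g-rind k)

rind-dirSum : ∀ {n m} {f : BoolFun n} {g : BoolFun m} → RindLtHalf f n → RindLeHalf g m →
  ∀ k → RindLtHalf (dirSum f k g) (n + k * m)
rind-dirSum {f = f} {g} f-rind g-rind k =
  rind-split-< {F₁ = f} {F₂ = kfold k g} (λ _ → refl) f-rind (rind-kfold g-rind k)

⟨⟩-⊕ : ∀ {N} (x y q : F2^ N) → ⟨ x ⊕ y , q ⟩ ≡ ⟨ x , q ⟩ xor ⟨ y , q ⟩
⟨⟩-⊕ [] [] [] = refl
⟨⟩-⊕ (a ∷ x) (b ∷ y) (c ∷ q) =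
  trans (cong (((a xor b) ∧ c) xor_) (⟨⟩-⊕ x y q)) (∧-xor-interchange a b c ⟨ x , q ⟩ ⟨ y , q ⟩)

D2-restrictˡ : ∀ {p q} (F : BoolFun (p + q)) (a b : F2^ p) w →
  D2 (a ++ zeroV) (b ++ zeroV) F w ≡ D2 a b (λ x → F (x ++ drop p w)) (take p w)
D2-restrictˡ {p} F a b w =
  sym (trans (D2-∘-affine ++y-⊕ F a b (take p w)) (cong (D2 (a ++ zeroV) (b ++ zeroV) F) (take++drop≡id p w)))
  where
  ++y-⊕ : ∀ u a → (u ⊕ a) ++ drop p w ≡ (u ++ drop p w) ⊕ (a ++ zeroV)
  ++y-⊕ u a = sym (trans (++-⊕ u a (drop p w) zeroV) (cong ((u ⊕ a) ++_) (⊕-identityʳ (drop p w))))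

D2-MM-vanishes : ∀ {t} (π : F2^ t → F2^ t) (φ : F2^ t → Bool) (a b : F2^ t) w →
  D2 (a ++ zeroV) (b ++ zeroV) (MM π φ) w ≡ false
D2-MM-vanishes {t} π φ a b w = begin
  D2 (a ++ zeroV) (b ++ zeroV) (MM π φ) w
    ≡⟨ D2-restrictˡ (MM π φ) a b w ⟩
  D2 a b (λ x → MM π φ (x ++ y)) x₀
    ≡⟨ D2-cong (λ x → cong₂ (λ x' y' → ⟨ x' , π y' ⟩ xor φ y') (take-++ x y) (drop-++ x y)) a b x₀ ⟩
  D2 a b (λ x → ⟨ x , π y ⟩ xor φ y) x₀
    ≡⟨ D2-xor (⟨_, π y ⟩) (λ _ → φ y) a b x₀ ⟩
  D2 a b (⟨_, π y ⟩) x₀ xor D2 a b (λ _ → φ y) x₀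
    ≡⟨ cong₂ _xor_ (D2-additive ⟨_, π y ⟩ (λ x x' → ⟨⟩-⊕ x x' (π y)) a b x₀) (D2-const (φ y) a b x₀) ⟩
  false ∎
  where
  open ≡-Reasoning
  y : F2^ t
  y = drop t w
  x₀ : F2^ t
  x₀ = take t w

InMSharp⇒relaxedMSubspace : ∀ {N} {F : BoolFun N} → InMSharp F →
  Σ ℕ λ t → t + t ≡ N × Σ (Fin t → F2^ N) (IsRelaxedMSubspace F t)
InMSharp⇒relaxedMSubspace {F = F} (t , refl , π , φ , M , (M⁻¹ , _ , M⁻¹M≡id) , v , w , c , F-def) =
  t , refl , B , B-indep , B-relaxed
  where
  -- the rows of M⁻¹ that M sends to the x-directions of the Maiorana–McFarland function
  B : Fin t → F2^ (t + t)
  B i = lookup M⁻¹ (i ↑ˡ t)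

  _·M : F2^ (t + t) → F2^ (t + t)
  u ·M = vecMat u M

  ·M-isLinear : IsLinear _·M
  ·M-isLinear = lincomb-isLinear (lookup M)

  B·k·M : ∀ k → lincomb B k ·M ≡ k ++ zeroV
  B·k·M k = trans (cong _·M (lincomb-↑ˡ t t (lookup M⁻¹) k)) (M⁻¹M≡id (k ++ zeroV))

  B-indep : LinIndep B
  B-indep k B·k≡0 = begin
    k                           ≡⟨ take-++ k zeroV ⟨
    take t (k ++ zeroV)         ≡⟨ cong (take t) (B·k·M k) ⟨
    take t (lincomb B k ·M)     ≡⟨ cong (take t ∘ _·M) B·k≡0 ⟩
    take t (zeroV ·M)           ≡⟨ cong (take t) (IsLinear.zero-homo ·M-isLinear) ⟩
    take t zeroV                ≡⟨ IsLinear.zero-homo (take-isLinear t) ⟩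
    zeroV                       ∎
    where open ≡-Reasoning

  affine : F2^ (t + t) → F2^ (t + t)
  affine u = u ·M ⊕ v

  affine-⊕ : ∀ u a → affine (u ⊕ a) ≡ affine u ⊕ a ·M
  affine-⊕ u a = trans (cong (_⊕ v) (IsLinear.⊕-homo ·M-isLinear u a)) (⊕-swapʳ (u ·M) (a ·M) v)

  D2-MM∘affine-vanishes : ∀ k k' z → D2 (lincomb B k) (lincomb B k') (MM π φ ∘ affine) z ≡ false
  D2-MM∘affine-vanishes k k' z = begin
    D2 (lincomb B k) (lincomb B k') (MM π φ ∘ affine) z
      ≡⟨ D2-∘-affine affine-⊕ (MM π φ) (lincomb B k) (lincomb B k') z ⟩
    D2 (lincomb B k ·M) (lincomb B k' ·M) (MM π φ) (affine z)
      ≡⟨ cong₂ (λ a b → D2 a b (MM π φ) (affine z)) (B·k·M k) (B·k·M k') ⟩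
    D2 (k ++ zeroV) (k' ++ zeroV) (MM π φ) (affine z)
      ≡⟨ D2-MM-vanishes π φ k k' (affine z) ⟩
    false ∎
    where open ≡-Reasoning

  D2-F-vanishes : ∀ k k' z → D2 (lincomb B k) (lincomb B k') F z ≡ false
  D2-F-vanishes k k' z = begin
    D2 a b F z
      ≡⟨ D2-cong F-def a b z ⟩
    D2 a b (λ u → MM π φ (affine u) xor ⟨ u , w ⟩ xor c) z
      ≡⟨ D2-xor (MM π φ ∘ affine) (λ u → ⟨ u , w ⟩ xor c) a b z ⟩
    D2 a b (MM π φ ∘ affine) z xor D2 a b (λ u → ⟨ u , w ⟩ xor c) z
      ≡⟨ cong (D2 a b (MM π φ ∘ affine) z xor_) (D2-xor ⟨_, w ⟩ (λ _ → c) a b z) ⟩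
    D2 a b (MM π φ ∘ affine) z xor D2 a b ⟨_, w ⟩ z xor D2 a b (λ _ → c) z
      ≡⟨ cong₂ _xor_ (D2-MM∘affine-vanishes k k' z)
                     (cong₂ _xor_ (D2-additive ⟨_, w ⟩ (λ x y → ⟨⟩-⊕ x y w) a b z) (D2-const c a b z)) ⟩
    false ∎
    where
    open ≡-Reasoning
    a b : F2^ (t + t)
    a = lincomb B k
    b = lincomb B k'

  B-relaxed : ∀ k k' → D2-Constant F (lincomb B k) (lincomb B k')
  B-relaxed k k' = false , D2-F-vanishes k k'

mainTheorem8 : ∀ {n m : ℕ} (f : BoolFun n) (g : BoolFun m) →
    IsBent f → IsBent g → RindLtHalf f n → RindLeHalf g m →
    ∀ (k : ℕ) → ¬ InMSharp (dirSum f k g)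
mainTheorem8 {n} {m} f g _ _ f-rind g-rind k inM# =
  let t , t+t≡N , B , B-relaxed = InMSharp⇒relaxedMSubspace inM#
      2t≡N : 2 * t ≡ n + k * m
      2t≡N = trans (cong (t +_) (+-identityʳ t)) t+t≡N
  in <-irrefl 2t≡N (rind-dirSum {f = f} {g = g} f-rind g-rind k t B B-relaxed)
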